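{- Let $b\ge2$ and $N$ be positive integers with $\gcd(N,b)=1$ and $|\mathcal{M}_b(N)|>1$. Then there exists a positive integer $z$ with $\gcd(z,b)=1$ such that $\mathcal{M}_b(zN)=\{|b|_N\}$.
   Context: $|b|_N$ denotes the multiplicative order of $b$ modulo $N$ (defined only when $\gcd(N,b)=1$), and $\mathbb{U}_N=\{x: 1\le x<N,\ \gcd(x,N)=1\}$. Midy's set: for an integer $d\ge 2$ dividing $|b|_N$, put $L=|b|_N$ and $k=L/d$. For $x\in\mathbb{U}_N$, let $a_1\cdots a_L$ be the base-$b$ digits (padded with leading zeros to exactly $L$ digits) of the integer $x(b^L-1)/N$ (the period of the base-$b$ expansion of $x/N$). For $j=1,\dots,d$ let $A_j=[a_{(j-1)k+1}\cdots a_{jk}]_b$ be the integer with the $j$-th block of $k$ digits, and $S_d(x)=\sum_{j=1}^d A_j$. $N$ has the Midy property for $b$ and $d$ if $b^k-1\mid S_d(x)$ for all $x\in\mathbb{U}_N$; the Midy set $\mathcal{M}_b(N)$ is the set of integers $d\ge2$ dividing $|b|_N$ for which this holds. -}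

module Defs where

open import Data.Nat using (ℕ; zero; suc; _+_; _*_; _∸_; _^_; _≤_; _<_)
open import Data.Nat.DivMod using (_/_; _%_)
open import Data.Nat.Divisibility using (_∣_; _∣?_)
open import Data.Nat.Coprimality using (Coprime)
open import Data.List using (List; []; _∷_; _++_; [_]; take; drop; foldl)
open import Data.Product using (_×_)
open import Relation.Nullary.Decidable using (does)
open import Data.Bool using (if_then_else_)

-- Total versions of quotient / remainder (only ever used with nonzero divisors;
-- the value at divisor 0 is an irrelevant convention).
quot : ℕ → ℕ → ℕ
quot m zero    = 0
quot m (suc n) = m / suc n

rem : ℕ → ℕ → ℕ
rem m zero    = m
rem m (suc n) = m % suc n

-- Multiplicative order |b|_N: the least L ≥ 1 with N ∣ b^L - 1.
-- Searched among L = 1, …, N (for gcd(N,b) = 1, N ≥ 1 the order is ≤ φ(N) ≤ N).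
-- Returns 0 if no such L ≤ N exists (only when gcd(N,b) ≠ 1; then undefined in the paper).
ordSearch : ℕ → ℕ → ℕ → ℕ → ℕ
ordSearch b N zero       L = 0
ordSearch b N (suc fuel) L =
  if does (N ∣? (b ^ L ∸ 1)) then L else ordSearch b N fuel (suc L)

ord : ℕ → ℕ → ℕ
ord b N = ordSearch b N N 1

digits : ℕ → ℕ → ℕ → List ℕ
digits b zero    X = []
digits b (suc L) X = digits b L (quot X b) ++ [ rem X b ]

fromDigits : ℕ → List ℕ → ℕ
fromDigits b = foldl (λ acc a → acc * b + a) 0

-- A_j for j = 1, …, d : the j-th block of k digits.
block : ℕ → ℕ → List ℕ → ℕ → ℕ
block b k ds j = fromDigits b (take k (drop ((j ∸ 1) * k) ds))

sumBlocks : ℕ → ℕ → List ℕ → ℕ → ℕ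
sumBlocks b k ds zero    = 0
sumBlocks b k ds (suc d) = sumBlocks b k ds d + block b k ds (suc d)

S : ℕ → ℕ → ℕ → ℕ → ℕ
S b N d x =
  let L = ord b N
      k = quot L d
      X = quot (x * (b ^ L ∸ 1)) N
  in sumBlocks b k (digits b L X) d

MidyProperty : ℕ → ℕ → ℕ → Set
MidyProperty b N d =
  ∀ x → 1 ≤ x → x < N → Coprime x N → (b ^ quot (ord b N) d ∸ 1) ∣ S b N d x

InMidySet : ℕ → ℕ → ℕ → Set
InMidySet b N d = 2 ≤ d × d ∣ ord b N × MidyProperty b N d

module Submission where

-- Let L = |b|_N.  Writing X(x) = x(b^L - 1)/N for the period of x/N,
-- the block sum S_d(x) is congruent to X(x) modulo b^k - 1 (cut the L digits into
-- d blocks of k digits and use b^k ≡ 1).  So d ∈ 𝓜_b(N) says exactly that b^k - 1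
-- divides every period.  Taking x = 1 for a single d ∈ 𝓜_b(N) already gives
-- b - 1 ∣ X(1) = (b^L - 1)/N; put z = X(1)/(b - 1).  Then zN = (b^L - 1)/(b - 1) is
-- the repunit R_L = 1 + b + ⋯ + b^(L-1), for which everything is explicit:
-- |b|_{R_L} = L, the periods are x(b - 1), and b^k - 1 ∣ b - 1 forces k = 1.
-- Hence 𝓜_b(zN) = {L}.

open import Defs
open import Data.Nat
open import Data.Nat.Properties
open import Data.Nat.DivMod
open import Data.Nat.Divisibility
open import Data.Nat.Coprimality using (Coprime; coprime-divisor; 1-coprimeTo)
open import Data.List using (List; _∷_; _++_; [_]; take; drop; length)
open import Data.List.Properties using (length-++; length-drop; ++-identityʳ; ++-assoc; foldl-++; take-all; drop-all)
open import Data.Fin using (toℕ; fromℕ<)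
open import Data.Fin.Properties using (pigeonhole; toℕ-fromℕ<; toℕ<n)
open import Data.Product using (_×_; _,_; proj₁; proj₂; ∃-syntax)
open import Data.Sum using (inj₁; inj₂)
open import Data.Empty using (⊥-elim)
open import Relation.Nullary using (¬_; yes; no)
open import Relation.Binary.PropositionalEquality hiding ([_])
open import Function.Bundles using (_⇔_; mk⇔; Equivalence)
open import Data.Nat.Tactic.RingSolver using (solve-∀)

open ≡-Reasoning

-- Congruences on ℕ

-- Congruence modulo m, phrased without subtraction.
infix 4 _≡_⟨mod_⟩
_≡_⟨mod_⟩ : ℕ → ℕ → ℕ → Set
a ≡ x ⟨mod m ⟩ = ∃[ p ] ∃[ q ] (a + p * m ≡ x + q * m)

≡mod-refl : ∀ {a m} → a ≡ a ⟨mod m ⟩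
≡mod-refl = 0 , 0 , refl

≡mod-trans : ∀ {a x y m} → a ≡ x ⟨mod m ⟩ → x ≡ y ⟨mod m ⟩ → a ≡ y ⟨mod m ⟩
≡mod-trans {a} {x} {y} {m} (p , q , a≡x) (p′ , q′ , x≡y) = p + p′ , q′ + q , (begin
  a + (p + p′) * m       ≡⟨ cong (a +_) (*-distribʳ-+ m p p′) ⟩
  a + (p * m + p′ * m)   ≡⟨ +-assoc a _ _ ⟨
  a + p * m + p′ * m     ≡⟨ cong (_+ p′ * m) a≡x ⟩
  x + q * m + p′ * m     ≡⟨ +-assoc x _ _ ⟩
  x + (q * m + p′ * m)   ≡⟨ cong (x +_) (+-comm (q * m) _) ⟩
  x + (p′ * m + q * m)   ≡⟨ +-assoc x _ _ ⟨
  x + p′ * m + q * m     ≡⟨ cong (_+ q * m) x≡y ⟩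
  y + q′ * m + q * m     ≡⟨ +-assoc y _ _ ⟩
  y + (q′ * m + q * m)   ≡⟨ cong (y +_) (*-distribʳ-+ m q′ q) ⟨
  y + (q′ + q) * m       ∎)

≡mod-+ʳ : ∀ {a x m} c → a ≡ x ⟨mod m ⟩ → a + c ≡ x + c ⟨mod m ⟩
≡mod-+ʳ {a} {x} {m} c (p , q , a≡x) = p , q , (begin
  a + c + p * m   ≡⟨ +-assoc a c _ ⟩
  a + (c + p * m) ≡⟨ cong (a +_) (+-comm c _) ⟩
  a + (p * m + c) ≡⟨ +-assoc a _ c ⟨
  a + p * m + c   ≡⟨ cong (_+ c) a≡x ⟩
  x + q * m + c   ≡⟨ +-assoc x _ c ⟩
  x + (q * m + c) ≡⟨ cong (x +_) (+-comm _ c) ⟩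
  x + (c + q * m) ≡⟨ +-assoc x c _ ⟨
  x + c + q * m   ∎)

≡mod-∣ : ∀ {a x m} → a ≡ x ⟨mod m ⟩ → m ∣ a ⇔ m ∣ x
≡mod-∣ {a} {x} {m} (p , q , a≡x) = mk⇔
  (λ m∣a → ∣m+n∣m⇒∣n (subst (m ∣_) (trans a≡x (+-comm x _)) (∣m∣n⇒∣m+n m∣a (n∣m*n p))) (n∣m*n q))
  (λ m∣x → ∣m+n∣m⇒∣n (subst (m ∣_) (trans (sym a≡x) (+-comm a _)) (∣m∣n⇒∣m+n m∣x (n∣m*n q))) (n∣m*n p))

-- Repunits

repunit : ℕ → ℕ → ℕ
repunit b zero    = 0
repunit b (suc k) = suc (b * repunit b k)

pow≡1+repunit : ∀ c k → suc c ^ k ≡ suc (c * repunit (suc c) k)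
pow≡1+repunit c zero    = cong suc (sym (*-zeroʳ c))
pow≡1+repunit c (suc k) = begin
  suc c * suc c ^ k                   ≡⟨ cong (suc c *_) (pow≡1+repunit c k) ⟩
  suc c * suc (c * r)                 ≡⟨ geometric c r ⟩
  suc (c * suc (suc c * r))           ∎
  where
  r : ℕ
  r = repunit (suc c) k
  geometric : ∀ c r → suc c * suc (c * r) ≡ suc (c * suc (suc c * r))
  geometric = solve-∀

pow∸1≡repunit : ∀ c k → suc c ^ k ∸ 1 ≡ c * repunit (suc c) k
pow∸1≡repunit c k = cong (_∸ 1) (pow≡1+repunit c k)

pow≡suc[pow∸1] : ∀ c k → suc c ^ k ≡ suc (suc c ^ k ∸ 1)
pow≡suc[pow∸1] c k = trans (pow≡1+repunit c k) (cong suc (sym (pow∸1≡repunit c k)))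

repunit-mono : ∀ c {m n} → m ≤ n → repunit (suc c) m ≤ repunit (suc c) n
repunit-mono c {n = zero}  z≤n = ≤-refl
repunit-mono c {m} {suc n} m≤1+n with m≤n⇒m<n∨m≡n m≤1+n
... | inj₂ refl      = ≤-refl
... | inj₁ (s≤s m≤n) =
  ≤-trans (repunit-mono c m≤n) (≤-trans (m≤n*m _ (suc c)) (n≤1+n _))

n≤repunit : ∀ c n → n ≤ repunit (suc c) n
n≤repunit c zero    = z≤n
n≤repunit c (suc n) = s≤s (≤-trans (n≤repunit c n) (m≤n*m _ (suc c)))

-- A nonempty repunit is ≡ 1 (mod b), hence coprime to b.
repunit-coprime : ∀ b k → 1 ≤ k → Coprime (repunit b k) b
repunit-coprime b (suc k) _ {i} (i∣R , i∣b) =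
  ∣1⇒≡1 (∣m+n∣m⇒∣n (subst (i ∣_) (+-comm 1 (b * repunit b k)) i∣R) (∣m⇒∣m*n _ i∣b))

pred*repunit<repunit : ∀ c j → suc c * repunit (suc (suc c)) j < repunit (suc (suc c)) (suc j)
pred*repunit<repunit c j = s≤s (*-monoˡ-≤ (repunit (suc (suc c)) j) (n≤1+n (suc c)))

-- Block sums of digit lists

take-++ˡ : ∀ {A : Set} n (xs ys : List A) → n ≤ length xs → take n (xs ++ ys) ≡ take n xs
take-++ˡ zero    xs       ys _        = refl
take-++ˡ (suc n) (x ∷ xs) ys (s≤s n≤) = cong (x ∷_) (take-++ˡ n xs ys n≤)

drop-++ˡ : ∀ {A : Set} n (xs ys : List A) → n ≤ length xs → drop n (xs ++ ys) ≡ drop n xs ++ ys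
drop-++ˡ zero    xs       ys _        = refl
drop-++ˡ (suc n) (x ∷ xs) ys (s≤s n≤) = drop-++ˡ n xs ys n≤

block-++ : ∀ b k ds e j → suc j * k ≤ length ds →
  block b k (ds ++ e) (suc j) ≡ block b k ds (suc j)
block-++ b k ds e j bound = cong (fromDigits b) (begin
  take k (drop (j * k) (ds ++ e))   ≡⟨ cong (take k) (drop-++ˡ (j * k) ds e (m+n≤o⇒n≤o k bound)) ⟩
  take k (drop (j * k) ds ++ e)     ≡⟨ take-++ˡ k (drop (j * k) ds) e room ⟩
  take k (drop (j * k) ds)          ∎)
  where
  room : k ≤ length (drop (j * k) ds)
  room = subst (k ≤_) (sym (length-drop (j * k) ds)) (m+n≤o⇒m≤o∸n k bound)

sumBlocks-++ : ∀ b k ds e d → d * k ≤ length ds →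
  sumBlocks b k (ds ++ e) d ≡ sumBlocks b k ds d
sumBlocks-++ b k ds e zero    _     = refl
sumBlocks-++ b k ds e (suc d) bound =
  cong₂ _+_ (sumBlocks-++ b k ds e d (m+n≤o⇒n≤o k bound)) (block-++ b k ds e d bound)

sumBlocks-snoc : ∀ b k ds e d → length ds ≡ d * k → length e ≡ k →
  sumBlocks b k (ds ++ e) (suc d) ≡ sumBlocks b k ds d + fromDigits b e
sumBlocks-snoc b k ds e d ∣ds∣ ∣e∣ =
  cong₂ _+_ (sumBlocks-++ b k ds e d (≤-reflexive (sym ∣ds∣))) lastBlock
  where
  lastBlock : block b k (ds ++ e) (suc d) ≡ fromDigits b e
  lastBlock = cong (fromDigits b) (begin
    take k (drop (d * k) (ds ++ e))   ≡⟨ cong (take k) (drop-++ˡ (d * k) ds e (≤-reflexive (sym ∣ds∣))) ⟩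
    take k (drop (d * k) ds ++ e)     ≡⟨ cong (λ t → take k (t ++ e)) (drop-all (d * k) ds (≤-reflexive ∣ds∣)) ⟩
    take k e                          ≡⟨ take-all k e (≤-reflexive ∣e∣) ⟩
    e                                 ∎)

-- The multiplicative order computed by `ord`

ordSearch-finds : ∀ b N f s L₀ → s ≤ L₀ → L₀ < s + f → N ∣ b ^ L₀ ∸ 1 →
  s ≤ ordSearch b N f s × ordSearch b N f s < s + f × N ∣ b ^ ordSearch b N f s ∸ 1
ordSearch-finds b N zero    s L₀ s≤L₀ L₀<s+0 _ = ⊥-elim (<⇒≱ (subst (L₀ <_) (+-identityʳ s) L₀<s+0) s≤L₀)
ordSearch-finds b N (suc f) s L₀ s≤L₀ L₀<s+f N∣ with N ∣? (b ^ s ∸ 1)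
... | yes N∣s = ≤-refl , m<m+n s z<s , N∣s
... | no N∤s with m≤n⇒m<n∨m≡n s≤L₀
...   | inj₂ refl = ⊥-elim (N∤s N∣)
...   | inj₁ s<L₀ with ordSearch-finds b N f (suc s) L₀ s<L₀ (subst (L₀ <_) (+-suc s f) L₀<s+f) N∣
...     | s<r , r<s+f , N∣r = <⇒≤ s<r , subst (ordSearch b N f (suc s) <_) (sym (+-suc s f)) r<s+f , N∣r

ordSearch-least : ∀ b N f s L → (∀ j → s ≤ j → j < L → ¬ N ∣ b ^ j ∸ 1) →
  s ≤ L → L < s + f → N ∣ b ^ L ∸ 1 → ordSearch b N f s ≡ L
ordSearch-least b N zero    s L _     s≤L L<s+0 _ = ⊥-elim (<⇒≱ (subst (L <_) (+-identityʳ s) L<s+0) s≤L)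
ordSearch-least b N (suc f) s L fails s≤L L<s+f N∣ with N ∣? (b ^ s ∸ 1) | m≤n⇒m<n∨m≡n s≤L
... | yes N∣s | inj₁ s<L  = ⊥-elim (fails s ≤-refl s<L N∣s)
... | yes _   | inj₂ s≡L  = s≡L
... | no N∤s  | inj₂ refl = ⊥-elim (N∤s N∣)
... | no _    | inj₁ s<L  =
  ordSearch-least b N f (suc s) L (λ j s<j → fails j (<⇒≤ s<j)) s<L (subst (L <_) (+-suc s f) L<s+f) N∣

%≡⇒∣∸ : ∀ a a′ N .{{_ : NonZero N}} → a % N ≡ a′ % N → N ∣ a ∸ a′
%≡⇒∣∸ a a′ N a≡a′ = divides (a / N ∸ a′ / N) (begin
  a ∸ a′                                        ≡⟨ cong₂ _∸_ (m≡m%n+[m/n]*n a N) (m≡m%n+[m/n]*n a′ N) ⟩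
  (a % N + a / N * N) ∸ (a′ % N + a′ / N * N)   ≡⟨ cong (λ t → (a % N + a / N * N) ∸ (t + a′ / N * N)) a≡a′ ⟨
  (a % N + a / N * N) ∸ (a % N + a′ / N * N)    ≡⟨ [m+n]∸[m+o]≡n∸o (a % N) _ _ ⟩
  a / N * N ∸ a′ / N * N                        ≡⟨ *-distribʳ-∸ N (a / N) (a′ / N) ⟨
  (a / N ∸ a′ / N) * N                          ∎)

coprime-cancel-pow : ∀ b N i {Y} → Coprime N b → N ∣ b ^ i * Y → N ∣ Y
coprime-cancel-pow b N zero    {Y} _   N∣ = subst (N ∣_) (+-identityʳ Y) N∣
coprime-cancel-pow b N (suc i) {Y} cop N∣ =
  coprime-cancel-pow b N i cop (coprime-divisor cop (subst (N ∣_) (*-assoc b (b ^ i) Y) N∣))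

-- For gcd(N, b) = 1 some exponent 1 ≤ L ≤ N has N ∣ b^L - 1: two of the N + 1
-- powers b^0, …, b^N agree modulo N, and the smaller power can be cancelled.
order-exists : ∀ b N → 1 ≤ N → Coprime N b → ∃[ L ] (1 ≤ L × L ≤ N × N ∣ b ^ L ∸ 1)
order-exists b N@(suc _) _ cop with pigeonhole (n<1+n N) (λ i → fromℕ< (m%n<n (b ^ toℕ i) N))
... | i , j , i<j , same =
  toℕ j ∸ toℕ i , m<n⇒0<n∸m i<j , ≤-trans (m∸n≤m (toℕ j) (toℕ i)) (s≤s⁻¹ (toℕ<n j)) ,
  coprime-cancel-pow b N (toℕ i) cop (subst (N ∣_) factor (%≡⇒∣∸ (b ^ toℕ j) (b ^ toℕ i) N residues))
  where
  residues : b ^ toℕ j % N ≡ b ^ toℕ i % N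
  residues = trans (sym (toℕ-fromℕ< _)) (trans (cong toℕ (sym same)) (toℕ-fromℕ< _))
  factor : b ^ toℕ j ∸ b ^ toℕ i ≡ b ^ toℕ i * (b ^ (toℕ j ∸ toℕ i) ∸ 1)
  factor = begin
    b ^ toℕ j ∸ b ^ toℕ i
      ≡⟨ cong (λ t → b ^ t ∸ b ^ toℕ i) (m+[n∸m]≡n (<⇒≤ i<j)) ⟨
    b ^ (toℕ i + (toℕ j ∸ toℕ i)) ∸ b ^ toℕ i
      ≡⟨ cong₂ _∸_ (^-distribˡ-+-* b (toℕ i) _) (sym (*-identityʳ (b ^ toℕ i))) ⟩
    b ^ toℕ i * b ^ (toℕ j ∸ toℕ i) ∸ b ^ toℕ i * 1
      ≡⟨ *-distribˡ-∸ (b ^ toℕ i) _ 1 ⟨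
    b ^ toℕ i * (b ^ (toℕ j ∸ toℕ i) ∸ 1) ∎

ord-spec : ∀ b N → 1 ≤ N → Coprime N b → 1 ≤ ord b N × ord b N ≤ N × N ∣ b ^ ord b N ∸ 1
ord-spec b N N≥1 cop with order-exists b N N≥1 cop
... | L , L≥1 , L≤N , N∣ with ordSearch-finds b N N 1 L L≥1 (s≤s L≤N) N∣
...   | ord≥1 , ord<1+N , N∣ord = ord≥1 , s≤s⁻¹ ord<1+N , N∣ord

ord-least : ∀ b N L → 1 ≤ L → L ≤ N → N ∣ b ^ L ∸ 1 →
  (∀ j → 1 ≤ j → j < L → ¬ N ∣ b ^ j ∸ 1) → ord b N ≡ L
ord-least b N L L≥1 L≤N N∣ smaller = ordSearch-least b N N 1 L smaller L≥1 (s≤s L≤N) N∣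

-- If d ∣ L then L = d·(L/d) (also for d = 0, where L = 0).
divisor-cofactor : ∀ L d → d ∣ L → L ≡ d * quot L d
divisor-cofactor L zero    0∣L = 0∣⇒≡0 0∣L
divisor-cofactor L (suc d) d∣L = sym (trans (*-comm (suc d) _) (m/n*n≡m d∣L))

quot-cancel : ∀ a n → 1 ≤ n → quot (a * n) n ≡ a
quot-cancel a (suc n) _ = m*n/n≡m a (suc n)

quot-self : ∀ n → 1 ≤ n → quot n n ≡ 1
quot-self (suc n) _ = n/n≡1 (suc n)

1≤m*n⇒1≤m : ∀ m {n} → 1 ≤ m * n → 1 ≤ m
1≤m*n⇒1≤m (suc m) _ = s≤s z≤n

coprime-∣ : ∀ {m n b} → m ∣ n → Coprime n b → Coprime m b
coprime-∣ m∣n cop (i∣m , i∣b) = cop (∣-trans i∣m m∣n , i∣b)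

midy⇒2≤ord : ∀ b N d → 1 ≤ ord b N → InMidySet b N d → 2 ≤ ord b N
midy⇒2≤ord b N d L≥1 (2≤d , d∣L , _) = ≤-trans 2≤d (∣⇒≤ {{>-nonZero L≥1}} d∣L)

-- Base-b digit expansions, for a base b = 1 + c ≥ 1

module Digits (c : ℕ) where

  b : ℕ
  b = suc c

  highPart : ℕ → ℕ → ℕ
  highPart zero    X = X
  highPart (suc k) X = highPart k (X / b)

  length-digits : ∀ k X → length (digits b k X) ≡ k
  length-digits zero    X = refl
  length-digits (suc k) X = begin
    length (digits b k (X / b) ++ [ X % b ])   ≡⟨ length-++ (digits b k (X / b)) ⟩
    length (digits b k (X / b)) + 1            ≡⟨ cong (_+ 1) (length-digits k (X / b)) ⟩
    k + 1                                      ≡⟨ +-comm k 1 ⟩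
    suc k                                      ∎

  digits-decomposition : ∀ k X → fromDigits b (digits b k X) + highPart k X * b ^ k ≡ X
  digits-decomposition zero    X = *-identityʳ X
  digits-decomposition (suc k) X = begin
    fromDigits b (digits b k (X / b) ++ [ X % b ]) + H * (b * b ^ k)
      ≡⟨ cong (_+ H * (b * b ^ k)) (foldl-++ _ 0 (digits b k (X / b)) [ X % b ]) ⟩
    low * b + X % b + H * (b * b ^ k)
      ≡⟨ shift low (X % b) H (b ^ k) b ⟩
    X % b + (low + H * b ^ k) * b
      ≡⟨ cong (λ t → X % b + t * b) (digits-decomposition k (X / b)) ⟩
    X % b + X / b * b
      ≡⟨ m≡m%n+[m/n]*n X b ⟨
    X ∎
    where
    low H : ℕ
    low = fromDigits b (digits b k (X / b))
    H = highPart k (X / b)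
    shift : ∀ l r h p b → l * b + r + h * (b * p) ≡ r + (l + h * p) * b
    shift = solve-∀

  digits-split : ∀ m k X → digits b (m + k) X ≡ digits b m (highPart k X) ++ digits b k X
  digits-split m zero    X rewrite +-identityʳ m = sym (++-identityʳ _)
  digits-split m (suc k) X rewrite +-suc m k = begin
    digits b (m + k) (X / b) ++ [ X % b ]
      ≡⟨ cong (_++ [ X % b ]) (digits-split m k (X / b)) ⟩
    (digits b m (highPart k (X / b)) ++ digits b k (X / b)) ++ [ X % b ]
      ≡⟨ ++-assoc (digits b m (highPart k (X / b))) _ _ ⟩
    digits b m (highPart k (X / b)) ++ digits b k (X / b) ++ [ X % b ] ∎

  highPart-< : ∀ k n X → X < b ^ (k + n) → highPart k X < b ^ n
  highPart-< k n X X< = *-cancelʳ-< (b ^ k) (highPart k X) (b ^ n) (≤-<-trans high≤X X<b^n*b^k)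
    where
    high≤X : highPart k X * b ^ k ≤ X
    high≤X = subst (highPart k X * b ^ k ≤_) (digits-decomposition k X) (m≤n+m _ _)
    X<b^n*b^k : X < b ^ n * b ^ k
    X<b^n*b^k = subst (X <_) (trans (^-distribˡ-+-* b k n) (*-comm (b ^ k) _)) X<

  -- The block-sum congruence: cutting the d·k digits of X into d blocks of k digits,
  -- the sum of the blocks is ≡ X modulo b^k - 1, because b^k ≡ 1.
  blockSum≡ : ∀ k d X → X < b ^ (d * k) → sumBlocks b k (digits b (d * k) X) d ≡ X ⟨mod b ^ k ∸ 1 ⟩
  blockSum≡ k zero    zero    _       = ≡mod-refl
  blockSum≡ k zero    (suc X) (s≤s ())
  blockSum≡ k (suc d) X       X<b^dk  =
    subst (_≡ X ⟨mod m ⟩) (sym blocks) (≡mod-trans (≡mod-+ʳ low IH) carry)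
    where
    m Y low : ℕ
    m = b ^ k ∸ 1
    Y = highPart k X
    low = fromDigits b (digits b k X)
    IH : sumBlocks b k (digits b (d * k) Y) d ≡ Y ⟨mod m ⟩
    IH = blockSum≡ k d Y (highPart-< k (d * k) X X<b^dk)
    blocks : sumBlocks b k (digits b (k + d * k) X) (suc d) ≡ sumBlocks b k (digits b (d * k) Y) d + low
    blocks = begin
      sumBlocks b k (digits b (k + d * k) X) (suc d)
        ≡⟨ cong (λ t → sumBlocks b k (digits b t X) (suc d)) (+-comm k (d * k)) ⟩
      sumBlocks b k (digits b (d * k + k) X) (suc d)
        ≡⟨ cong (λ t → sumBlocks b k t (suc d)) (digits-split (d * k) k X) ⟩
      sumBlocks b k (digits b (d * k) Y ++ digits b k X) (suc d)
        ≡⟨ sumBlocks-snoc b k _ _ d (length-digits (d * k) Y) (length-digits k X) ⟩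
      sumBlocks b k (digits b (d * k) Y) d + low ∎
    -- Y + low ≡ low + Y·b^k = X, since Y·b^k = Y + Y·m.
    carry : Y + low ≡ X ⟨mod m ⟩
    carry = Y , 0 , (begin
      Y + low + Y * m      ≡⟨ rearrange Y low m ⟩
      low + Y * suc m      ≡⟨ cong (λ t → low + Y * t) (pow≡suc[pow∸1] c k) ⟨
      low + Y * b ^ k      ≡⟨ digits-decomposition k X ⟩
      X                    ≡⟨ +-identityʳ X ⟨
      X + 0 * m            ∎)
      where
      rearrange : ∀ y l m → y + l + y * m ≡ l + y * suc m
      rearrange = solve-∀

  -- The period of x/N: the integer x(b^L - 1)/N whose L digits repeat, L = |b|_N.
  period : ℕ → ℕ → ℕ
  period N x = quot (x * (b ^ ord b N ∸ 1)) N

  period<pow : ∀ N x → 1 ≤ N → x ≤ N → period N x < b ^ ord b N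
  period<pow N@(suc _) x _ x≤N = ≤-<-trans period≤M (≤-reflexive (sym (pow≡suc[pow∸1] c (ord b N))))
    where
    M : ℕ
    M = b ^ ord b N ∸ 1
    period≤M : x * M / N ≤ M
    period≤M = ≤-trans (/-monoˡ-≤ N (*-monoˡ-≤ M x≤N))
                       (≤-reflexive (trans (cong (_/ N) (*-comm N M)) (m*n/n≡m M N)))

  midySum≡period : ∀ N d x → 1 ≤ N → x ≤ N → d ∣ ord b N →
    S b N d x ≡ period N x ⟨mod b ^ quot (ord b N) d ∸ 1 ⟩
  midySum≡period N d x N≥1 x≤N d∣L =
    blocks (ord b N) (quot (ord b N) d) (divisor-cofactor (ord b N) d d∣L) (period<pow N x N≥1 x≤N)
    where
    blocks : ∀ L k → L ≡ d * k → period N x < b ^ L →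
      sumBlocks b k (digits b L (period N x)) d ≡ period N x ⟨mod b ^ k ∸ 1 ⟩
    blocks .(d * k) k refl = blockSum≡ k d (period N x)

-- Repunits and Midy sets in base b = 2 + c

module Repunits (c : ℕ) where
  open Digits (suc c) public

  R : ℕ → ℕ
  R = repunit b

  -- |b|_{R_L} = L: R_L ∣ b^L - 1 = (b - 1)·R_L, while 0 < b^j - 1 < R_L for 1 ≤ j < L.
  ord-repunit : ∀ L → 1 ≤ L → ord b (R L) ≡ L
  ord-repunit L L≥1 = ord-least b (R L) L L≥1 (n≤repunit (suc c) L) R∣ too-small
    where
    R∣ : R L ∣ b ^ L ∸ 1
    R∣ = divides (suc c) (pow∸1≡repunit (suc c) L)
    too-small : ∀ j → 1 ≤ j → j < L → ¬ R L ∣ b ^ j ∸ 1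
    too-small (suc j) _ j<L R∣ =
      <⇒≱ (<-≤-trans (pred*repunit<repunit c (suc j)) (repunit-mono (suc c) j<L))
          (∣⇒≤ (subst (R L ∣_) (pow∸1≡repunit (suc c) (suc j)) R∣))

  period-repunit : ∀ L x → 1 ≤ L → period (R L) x ≡ x * suc c
  period-repunit L x L≥1 = begin
    quot (x * (b ^ ord b (R L) ∸ 1)) (R L) ≡⟨ cong (λ t → quot (x * (b ^ t ∸ 1)) (R L)) (ord-repunit L L≥1) ⟩
    quot (x * (b ^ L ∸ 1)) (R L)           ≡⟨ cong (λ t → quot (x * t) (R L)) (pow∸1≡repunit (suc c) L) ⟩
    quot (x * (suc c * R L)) (R L)         ≡⟨ cong (λ t → quot t (R L)) (*-assoc x (suc c) (R L)) ⟨
    quot (x * suc c * R L) (R L)           ≡⟨ quot-cancel (x * suc c) (R L) (≤-trans L≥1 (n≤repunit (suc c) L)) ⟩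
    x * suc c                              ∎

  -- b^k - 1 = (b - 1)·R_k divides b - 1 only if R_k ≤ 1, i.e. k ≤ 1.
  pow∸1∣pred⇒≤1 : ∀ k → b ^ k ∸ 1 ∣ suc c → k ≤ 1
  pow∸1∣pred⇒≤1 k ∣pred = ≤-trans (n≤repunit (suc c) k) (*-cancelˡ-≤ (suc c) bounded)
    where
    bounded : suc c * R k ≤ suc c * 1
    bounded = ≤-trans (∣⇒≤ (subst (_∣ suc c) (pow∸1≡repunit (suc c) k) ∣pred))
                      (≤-reflexive (sym (*-identityʳ (suc c))))

  -- 𝓜_b(R_L) = {L}: the Midy property at x = 1 forces k = 1, and for k = 1 it holds
  -- because every period x(b - 1) is divisible by b - 1.
  repunit-midySet : ∀ L → 2 ≤ L → ∀ d → InMidySet b (R L) d ⇔ d ≡ L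
  repunit-midySet L 2≤L d = mk⇔ only-L (λ d≡L → subst (InMidySet b (R L)) (sym d≡L) L∈)
    where
    L≥1 : 1 ≤ L
    L≥1 = ≤-trans (s≤s z≤n) 2≤L
    R≥2 : 2 ≤ R L
    R≥2 = ≤-trans 2≤L (n≤repunit (suc c) L)
    R≥1 : 1 ≤ R L
    R≥1 = ≤-trans (s≤s z≤n) R≥2

    only-L : InMidySet b (R L) d → d ≡ L
    only-L (_ , d∣ord , midy) =
      cofactor≤1 (quot (ord b (R L)) d) (trans (sym (ord-repunit L L≥1)) (divisor-cofactor _ d d∣ord)) k≤1
      where
      ∣period : b ^ quot (ord b (R L)) d ∸ 1 ∣ period (R L) 1
      ∣period = Equivalence.to (≡mod-∣ (midySum≡period (R L) d 1 R≥1 R≥1 d∣ord))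
                               (midy 1 ≤-refl R≥2 (1-coprimeTo (R L)))
      k≤1 : quot (ord b (R L)) d ≤ 1
      k≤1 = pow∸1∣pred⇒≤1 _ (subst (b ^ quot (ord b (R L)) d ∸ 1 ∣_) (trans (period-repunit L 1 L≥1) (*-identityˡ (suc c))) ∣period)
      cofactor≤1 : ∀ k → L ≡ d * k → k ≤ 1 → d ≡ L
      cofactor≤1 zero          L≡0   _ = ⊥-elim (<⇒≱ L≥1 (≤-reflexive (trans L≡0 (*-zeroʳ d))))
      cofactor≤1 (suc zero)    L≡d*1 _ = sym (trans L≡d*1 (*-identityʳ d))
      cofactor≤1 (suc (suc k)) _     (s≤s ())

    L∈ : InMidySet b (R L) L
    L∈ = 2≤L , subst (L ∣_) (sym (ord-repunit L L≥1)) ∣-refl , midy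
      where
      b^[L/L]∸1≡pred : b ^ quot (ord b (R L)) L ∸ 1 ≡ suc c
      b^[L/L]∸1≡pred = begin
        b ^ quot (ord b (R L)) L ∸ 1 ≡⟨ cong (λ t → b ^ quot t L ∸ 1) (ord-repunit L L≥1) ⟩
        b ^ quot L L ∸ 1             ≡⟨ cong (λ t → b ^ t ∸ 1) (quot-self L L≥1) ⟩
        b ^ 1 ∸ 1                    ≡⟨ cong (_∸ 1) (^-identityʳ b) ⟩
        suc c                        ∎
      midy : MidyProperty b (R L) L
      midy x _ x<R _ = Equivalence.from (≡mod-∣ (midySum≡period (R L) L x R≥1 (<⇒≤ x<R) L∣ord))
        (subst₂ _∣_ (sym b^[L/L]∸1≡pred) (sym (period-repunit L x L≥1)) (n∣m*n x))
        where
        L∣ord : L ∣ ord b (R L)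
        L∣ord = subst (L ∣_) (sym (ord-repunit L L≥1)) ∣-refl

  -- One element d of 𝓜_b(N) already gives b - 1 ∣ (b^L - 1)/N, via x = 1.
  midy⇒pred∣period : ∀ N d → 1 ≤ N → Coprime N b → InMidySet b N d → suc c ∣ period N 1
  midy⇒pred∣period N d N≥1 cop d∈@(_ , d∣L , midy) =
    ∣-trans (m∣m*n (R k)) (subst (_∣ period N 1) (pow∸1≡repunit (suc c) k) ∣period)
    where
    k : ℕ
    k = quot (ord b N) d
    spec : 1 ≤ ord b N × ord b N ≤ N × N ∣ b ^ ord b N ∸ 1
    spec = ord-spec b N N≥1 cop
    1<N : 1 < N
    1<N = ≤-trans (midy⇒2≤ord b N d (proj₁ spec) d∈) (proj₁ (proj₂ spec))
    ∣period : b ^ k ∸ 1 ∣ period N 1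
    ∣period = Equivalence.to (≡mod-∣ (midySum≡period N d 1 N≥1 (<⇒≤ 1<N) d∣L))
                             (midy 1 ≤-refl 1<N (1-coprimeTo N))

  cofactor-repunit : ∀ N z → 1 ≤ N → N ∣ b ^ ord b N ∸ 1 → period N 1 ≡ z * suc c → z * N ≡ R (ord b N)
  cofactor-repunit N@(suc _) z _ N∣ period≡ = *-cancelˡ-≡ (z * N) (R L) (suc c) (begin
    suc c * (z * N)          ≡⟨ swap (suc c) z N ⟩
    z * suc c * N            ≡⟨ cong (_* N) period≡ ⟨
    period N 1 * N           ≡⟨ cong (λ t → t / N * N) (*-identityˡ (b ^ L ∸ 1)) ⟩
    (b ^ L ∸ 1) / N * N      ≡⟨ m/n*n≡m N∣ ⟩
    b ^ L ∸ 1                ≡⟨ pow∸1≡repunit (suc c) L ⟩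
    suc c * R L              ∎)
    where
    L : ℕ
    L = ord b N
    swap : ∀ p z n → p * (z * n) ≡ z * p * n
    swap = solve-∀

theorem2p12 : (b N : ℕ) → 2 ≤ b → 1 ≤ N → Coprime N b →
    (∃[ d₁ ] ∃[ d₂ ] (d₁ ≢ d₂ × InMidySet b N d₁ × InMidySet b N d₂)) →
    ∃[ z ] (1 ≤ z × Coprime z b ×
    (∀ d → InMidySet b (z * N) d ⇔ d ≡ ord b N))
theorem2p12 (suc (suc c)) N (s≤s (s≤s z≤n)) N≥1 cop (d , _ , _ , d∈ , _) =
  z , 1≤m*n⇒1≤m z (subst (1 ≤_) (sym zN≡R) R≥1) , coprime-∣ (m∣m*n N) zN-coprime ,
  λ d′ → subst (λ M → InMidySet b M d′ ⇔ d′ ≡ L) (sym zN≡R) (repunit-midySet L 2≤L d′)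
  where
  open Repunits c
  L : ℕ
  L = ord b N
  spec : 1 ≤ L × L ≤ N × N ∣ b ^ L ∸ 1
  spec = ord-spec b N N≥1 cop
  L≥1 : 1 ≤ L
  L≥1 = proj₁ spec
  2≤L : 2 ≤ L
  2≤L = midy⇒2≤ord b N d L≥1 d∈
  pred∣period : suc c ∣ period N 1
  pred∣period = midy⇒pred∣period N d N≥1 cop d∈
  z : ℕ
  z = quotient pred∣period
  zN≡R : z * N ≡ R L
  zN≡R = cofactor-repunit N z N≥1 (proj₂ (proj₂ spec)) (_∣_.equality pred∣period)
  R≥1 : 1 ≤ R L
  R≥1 = ≤-trans L≥1 (n≤repunit (suc c) L)
  zN-coprime : Coprime (z * N) b
  zN-coprime = subst (λ M → Coprime M b) (sym zN≡R) (repunit-coprime b L L≥1)
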